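{- Let $k\geq 1$, let $\tau,\tau'\in T_k$ be such that $\tau\preceq\tau'$, and let $w$ be a finite word whose $\mathrm{prefFO}$ $k$-type is $\tau$. Then there exists a finite word $w'$ such that the $\mathrm{prefFO}$ $k$-type of $w\cdot w'$ is $\tau'$.
   Context: $\Sigma$ is a finite alphabet. Prefix first-order logic on words ($\mathrm{prefFO}$): first-order logic over (finite or infinite) words on $\Sigma$ with the order $<$ on positions and a unary predicate for each letter, restricted to sentences which start with a quantification (existential or universal) of a variable $\bar x$, after which every further quantification is of the form $\exists x<\bar x$ or $\forall x<\bar x$ (together with Boolean combinations of such sentences). The $\mathrm{prefFO}$ $k$-type of a word $w$ is the set of all $\mathrm{prefFO}$ sentences of quantifier depth at most $k$ satisfied by $w$; $T_k$ is the set of $\mathrm{prefFO}$ $k$-types of words over $\Sigma$. The relation $\preceq$ on $T_k$ is defined by $\tau\preceq\tau'$ iff there exist finite words $u,v$ such that $u$ has $k$-type $\tau$ and $uv$ has $k$-type $\tau'$. -}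

module Defs where

open import Data.Nat using (ℕ; zero; suc; _≤_; _⊔_)
open import Data.Fin using (Fin; zero; suc; _<_)
open import Data.List using (List; length; lookup; _++_)
open import Data.Product using (Σ; _×_; _,_)
open import Data.Sum using (_⊎_)
open import Data.Empty using (⊥)
open import Relation.Nullary using (¬_)
open import Relation.Binary.PropositionalEquality using (_≡_)
open import Function.Bundles using (_⇔_)

Word : ℕ → Set
Word s = List (Fin s)

-- Variables of a bounded formula: the distinguished variable x̄, or one of
-- m variables bound by bounded quantifiers (de Bruijn indices).
data Var (m : ℕ) : Set where
  xbar : Var m
  var  : Fin m → Var m

-- Bounded formulas (inside the scope of x̄): every quantifier is ∃ x < x̄ or ∀ x < x̄.
data BForm (s : ℕ) : ℕ → Set where
  ltB   : ∀ {m} → Var m → Var m → BForm s m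
  eqB   : ∀ {m} → Var m → Var m → BForm s m
  letB  : ∀ {m} → Fin s → Var m → BForm s m
  notB  : ∀ {m} → BForm s m → BForm s m
  andB  : ∀ {m} → BForm s m → BForm s m → BForm s m
  orB   : ∀ {m} → BForm s m → BForm s m → BForm s m
  exB   : ∀ {m} → BForm s (suc m) → BForm s m
  allB  : ∀ {m} → BForm s (suc m) → BForm s m

data PrefFO (s : ℕ) : Set where
  exBar  : BForm s 0 → PrefFO s
  allBar : BForm s 0 → PrefFO s
  notS   : PrefFO s → PrefFO s
  andS   : PrefFO s → PrefFO s → PrefFO s
  orS    : PrefFO s → PrefFO s → PrefFO s

qdB : ∀ {s m} → BForm s m → ℕ
qdB (ltB _ _) = 0
qdB (eqB _ _) = 0
qdB (letB _ _) = 0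
qdB (notB φ) = qdB φ
qdB (andB φ ψ) = qdB φ ⊔ qdB ψ
qdB (orB φ ψ) = qdB φ ⊔ qdB ψ
qdB (exB φ) = suc (qdB φ)
qdB (allB φ) = suc (qdB φ)

qd : ∀ {s} → PrefFO s → ℕ
qd (exBar φ) = suc (qdB φ)
qd (allBar φ) = suc (qdB φ)
qd (notS φ) = qd φ
qd (andS φ ψ) = qd φ ⊔ qd ψ
qd (orS φ ψ) = qd φ ⊔ qd ψ

module _ {s : ℕ} (w : Word s) where
  Pos : Set
  Pos = Fin (length w)

  extend : ∀ {m} → Pos → (Fin m → Pos) → Fin (suc m) → Pos
  extend p ρ zero = p
  extend p ρ (suc i) = ρ i

  val : ∀ {m} → Pos → (Fin m → Pos) → Var m → Pos
  val b ρ xbar = b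
  val b ρ (var i) = ρ i

  semB : ∀ {m} → BForm s m → Pos → (Fin m → Pos) → Set
  semB (ltB x y) b ρ = val b ρ x < val b ρ y
  semB (eqB x y) b ρ = val b ρ x ≡ val b ρ y
  semB (letB a x) b ρ = lookup w (val b ρ x) ≡ a
  semB (notB φ) b ρ = ¬ semB φ b ρ
  semB (andB φ ψ) b ρ = semB φ b ρ × semB ψ b ρ
  semB (orB φ ψ) b ρ = semB φ b ρ ⊎ semB ψ b ρ
  semB (exB φ) b ρ = Σ Pos λ p → p < b × semB φ b (extend p ρ)
  semB (allB φ) b ρ = (p : Pos) → p < b → semB φ b (extend p ρ)

  noVars : Fin 0 → Pos
  noVars ()

  sat : PrefFO s → Set
  sat (exBar φ) = Σ Pos λ b → semB φ b noVars
  sat (allBar φ) = (b : Pos) → semB φ b noVars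
  sat (notS φ) = ¬ sat φ
  sat (andS φ ψ) = sat φ × sat ψ
  sat (orS φ ψ) = sat φ ⊎ sat ψ

SameType : ∀ {s} → ℕ → Word s → Word s → Set
SameType {s} k u v = (φ : PrefFO s) → qd φ ≤ k → (sat u φ ⇔ sat v φ)

-- Write k = d + 1. If w is empty then so is u. Otherwise let b be the last position of w:
-- since w and u have the same k-type, the Hintikka sentence "some position has the depth-d
-- type of b" holds in u, at a position c. Take for w′ the part of u v after c. By the
-- Ehrenfeucht–Fraïssé argument at the outermost quantifier, w w′ and u v have the same k-type
-- as soon as every position of either word has a position of the other with the same
-- depth-d pointed type. Positions up to b (resp. c) are matched inside w and u, because a
-- prefFO formula never looks beyond its mark; later positions are matched in lockstep,
-- because reading the same letter after d-equivalent marks keeps them d-equivalent.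

module Submission where

open import Defs
open import Data.Nat using (ℕ; zero; suc; _+_; _∸_; _⊔_; _≤_; _<_; z≤n; s≤s; s≤s⁻¹)
open import Data.Nat.Properties
  using ( ⊔-lub; m⊔n≤o⇒m≤o; m⊔n≤o⇒n≤o; n≤1+n; ≤-refl; ≤-reflexive; ≤-trans; <-irrefl; <⇒≱; <⇒≤
        ; ≤-<-trans; <-≤-trans; m≤n⇒m<n∨m≡n; +-suc; m≤n+m; m∸n+n≡m )

open import Data.Fin as Fin using (Fin; zero; suc; toℕ; fromℕ; fromℕ<; inject≤)
open import Data.Fin.Properties
  using (toℕ-injective; _<?_; _≟_; toℕ-fromℕ<; toℕ<n; toℕ-fromℕ; toℕ-inject≤; ≤-total)
open import Data.List using (List; []; _∷_; length; lookup; _++_; map; allFin; drop; filter)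
open import Data.List.Properties using (length-++-≤ˡ)
open import Data.List.Membership.Propositional using (_∈_)
open import Data.List.Membership.Propositional.Properties using (∈-allFin; ∈-map⁺; ∈-filter⁺; ∈-filter⁻)
open import Data.List.Relation.Unary.Any using (here; there)
open import Data.Product using (Σ; _×_; _,_; proj₁; proj₂)
open import Data.Product.Function.NonDependent.Propositional using (_×-⇔_)
open import Data.Sum using (inj₁; inj₂)
open import Data.Sum.Function.Propositional using (_⊎-⇔_)
open import Data.Empty using (⊥; ⊥-elim)
open import Relation.Nullary using (Dec; yes; no)
open import Function.Bundles using (_⇔_; mk⇔; Equivalence)
open import Function.Related.Propositional using (≡⇒)
open import Function.Related.TypeIsomorphisms using (¬-cong-⇔)
import Function.Properties.Equivalence as ⇔
open import Relation.Binary.PropositionalEquality using (_≡_; refl; sym; trans; cong; cong₂; subst; subst₂)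

open Equivalence using (to; from)

drop-lookup : ∀ {A : Set} (x : List A) (i : Fin (length x)) →
  drop (toℕ i) x ≡ lookup x i ∷ drop (suc (toℕ i)) x
drop-lookup (a ∷ x) zero = refl
drop-lookup (a ∷ x) (suc i) = drop-lookup x i

drop-∷⁻ : ∀ {A : Set} (x : List A) n {a r} → drop n x ≡ a ∷ r →
  Σ (Fin (length x)) λ i → toℕ i ≡ n × lookup x i ≡ a × drop (suc n) x ≡ r
drop-∷⁻ (a ∷ x) zero refl = zero , refl , refl , refl
drop-∷⁻ (a ∷ x) (suc n) h = let (i , i≡n , l , d) = drop-∷⁻ x n h in suc i , cong suc i≡n , l , d

drop-length-++ : ∀ {A : Set} (x z : List A) → drop (length x) (x ++ z) ≡ z
drop-length-++ [] z = refl
drop-length-++ (a ∷ x) z = drop-length-++ x z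

_⋖_ : ∀ {n} → Fin n → Fin n → Set
b ⋖ b′ = toℕ b′ ≡ suc (toℕ b)

⋖⇒< : ∀ {n} {b b′ : Fin n} → b ⋖ b′ → b Fin.< b′
⋖⇒< b⋖b′ = ≤-reflexive (sym b⋖b′)

<-⋖⇒≤ : ∀ {n} {b b′ p : Fin n} → b ⋖ b′ → p Fin.< b′ → p Fin.≤ b
<-⋖⇒≤ b⋖b′ p<b′ = s≤s⁻¹ (subst (_ ≤_) b⋖b′ p<b′)

≤-⋖⇒< : ∀ {n} {b b′ p : Fin n} → b ⋖ b′ → p Fin.≤ b → p Fin.< b′
≤-⋖⇒< b⋖b′ p≤b = ≤-<-trans p≤b (⋖⇒< b⋖b′)

⋖⇒≰ : ∀ {n} {b b′ : Fin n} → b ⋖ b′ → b′ Fin.≤ b → ⊥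
⋖⇒≰ b⋖b′ b′≤b = <⇒≱ (⋖⇒< b⋖b′) b′≤b

-- mark is the value of x̄, env assigns the m bounded variables.
record Pointed (s m : ℕ) : Set where
  constructor ⟨_,_,_⟩
  field
    word : Word s
    mark : Pos word
    env  : Fin m → Pos word

open Pointed

module _ {s : ℕ} where

  infix  4 _⊨_ _≈[_]_
  infixl 5 _▷_
  infix  6 _at_

  _⟦_⟧ : ∀ {m} (P : Pointed s m) → Var m → Pos (word P)
  P ⟦ v ⟧ = val (word P) (mark P) (env P) v

  _⊨_ : ∀ {m} → Pointed s m → BForm s m → Set
  P ⊨ φ = semB (word P) φ (mark P) (env P)

  _≈[_]_ : ∀ {m} → Pointed s m → ℕ → Pointed s m → Set
  P ≈[ d ] Q = ∀ φ → qdB φ ≤ d → P ⊨ φ ⇔ Q ⊨ φ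

  _▷_ : ∀ {m} (P : Pointed s m) → Pos (word P) → Pointed s (suc m)
  P ▷ p = ⟨ word P , mark P , extend (word P) p (env P) ⟩

  _at_ : (x : Word s) → Pos x → Pointed s 0
  x at b = ⟨ x , b , noVars x ⟩

  ≈-sym : ∀ {d m} {P Q : Pointed s m} → P ≈[ d ] Q → Q ≈[ d ] P
  ≈-sym e φ q = ⇔.sym (e φ q)

  ≈-trans : ∀ {d m} {P Q R : Pointed s m} → P ≈[ d ] Q → Q ≈[ d ] R → P ≈[ d ] R
  ≈-trans e e′ φ q = ⇔.trans (e φ q) (e′ φ q)

  ≈-weaken : ∀ {d d′ m} {P Q : Pointed s m} → d ≤ d′ → P ≈[ d′ ] Q → P ≈[ d ] Q
  ≈-weaken d≤d′ e φ q = e φ (≤-trans q d≤d′)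

  -- Every formula is a Boolean combination of prime formulas.
  data Prime {m} : BForm s m → Set where
    ltB  : ∀ v v′ → Prime (ltB v v′)
    eqB  : ∀ v v′ → Prime (eqB v v′)
    letB : ∀ a v → Prime (letB a v)
    exB  : ∀ φ → Prime (exB φ)
    allB : ∀ φ → Prime (allB φ)

  ≈-intro : ∀ {d m} {P Q : Pointed s m} →
    (∀ {φ} → Prime φ → qdB φ ≤ d → P ⊨ φ ⇔ Q ⊨ φ) → P ≈[ d ] Q
  ≈-intro h (ltB v v′) q = h (ltB v v′) q
  ≈-intro h (eqB v v′) q = h (eqB v v′) q
  ≈-intro h (letB a v) q = h (letB a v) q
  ≈-intro h (notB φ) q = ¬-cong-⇔ (≈-intro h φ q)
  ≈-intro h (andB φ ψ) q =
    ≈-intro h φ (m⊔n≤o⇒m≤o (qdB φ) _ q) ×-⇔ ≈-intro h ψ (m⊔n≤o⇒n≤o (qdB φ) _ q)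
  ≈-intro h (orB φ ψ) q =
    ≈-intro h φ (m⊔n≤o⇒m≤o (qdB φ) _ q) ⊎-⇔ ≈-intro h ψ (m⊔n≤o⇒n≤o (qdB φ) _ q)
  ≈-intro h (exB φ) q = h (exB φ) q
  ≈-intro h (allB φ) q = h (allB φ) q

  Forth Back : ∀ {m} → ℕ → Pointed s m → Pointed s m → Set
  Forth d P Q = ∀ p → p Fin.< mark P → Σ (Pos (word Q)) λ r → r Fin.< mark Q × P ▷ p ≈[ d ] Q ▷ r
  Back d P Q = ∀ r → r Fin.< mark Q → Σ (Pos (word P)) λ p → p Fin.< mark P × P ▷ p ≈[ d ] Q ▷ r

  ≈-back-and-forth : ∀ {d m} {P Q : Pointed s m} →
    P ≈[ 0 ] Q → Forth d P Q → Back d P Q → P ≈[ suc d ] Q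
  ≈-back-and-forth {d} {P = P} {Q} e₀ forth back = ≈-intro prime
    where
    prime : ∀ {φ} → Prime φ → qdB φ ≤ suc d → P ⊨ φ ⇔ Q ⊨ φ
    prime (ltB v v′) q = e₀ (ltB v v′) z≤n
    prime (eqB v v′) q = e₀ (eqB v v′) z≤n
    prime (letB a v) q = e₀ (letB a v) z≤n
    prime (exB φ) (s≤s q) = mk⇔
      (λ (p , p<b , h) → let (r , r<c , e) = forth p p<b in r , r<c , to (e φ q) h)
      (λ (r , r<c , h) → let (p , p<b , e) = back r r<c in p , p<b , from (e φ q) h)
    prime (allB φ) (s≤s q) = mk⇔
      (λ h r r<c → let (p , p<b , e) = back r r<c in to (e φ q) (h p p<b))
      (λ h p p<b → let (r , r<c , e) = forth p p<b in from (e φ q) (h r r<c))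

  ⊤B : ∀ {m} → BForm s m
  ⊤B = eqB xbar xbar

  ⋀ : ∀ {m} {A : Set} → List A → (A → BForm s m) → BForm s m
  ⋀ [] f = ⊤B
  ⋀ (a ∷ l) f = andB (f a) (⋀ l f)

  ⋁ : ∀ {m} {A : Set} → List A → (A → BForm s m) → BForm s m
  ⋁ [] f = notB ⊤B
  ⋁ (a ∷ l) f = orB (f a) (⋁ l f)

  qd-⋀ : ∀ {d m} {A : Set} (l : List A) (f : A → BForm s m) →
    (∀ a → qdB (f a) ≤ d) → qdB (⋀ l f) ≤ d
  qd-⋀ [] f h = z≤n
  qd-⋀ (a ∷ l) f h = ⊔-lub (h a) (qd-⋀ l f h)

  qd-⋁ : ∀ {d m} {A : Set} (l : List A) (f : A → BForm s m) →
    (∀ a → qdB (f a) ≤ d) → qdB (⋁ l f) ≤ d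
  qd-⋁ [] f h = z≤n
  qd-⋁ (a ∷ l) f h = ⊔-lub (h a) (qd-⋁ l f h)

  ⊨-⋀⁺ : ∀ {m} {A : Set} (l : List A) (f : A → BForm s m) {P : Pointed s m} →
    (∀ {a} → a ∈ l → P ⊨ f a) → P ⊨ ⋀ l f
  ⊨-⋀⁺ [] f h = refl
  ⊨-⋀⁺ (a ∷ l) f h = h (here refl) , ⊨-⋀⁺ l f (λ a∈l → h (there a∈l))

  ⊨-⋀⁻ : ∀ {m} {A : Set} (l : List A) (f : A → BForm s m) {P : Pointed s m} →
    P ⊨ ⋀ l f → ∀ {a} → a ∈ l → P ⊨ f a
  ⊨-⋀⁻ (a ∷ l) f (h , _) (here refl) = h
  ⊨-⋀⁻ (a ∷ l) f (_ , h) (there a∈l) = ⊨-⋀⁻ l f h a∈l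

  ⊨-⋁⁺ : ∀ {m} {A : Set} (l : List A) (f : A → BForm s m) {P : Pointed s m} {a} →
    a ∈ l → P ⊨ f a → P ⊨ ⋁ l f
  ⊨-⋁⁺ (a ∷ l) f (here refl) h = inj₁ h
  ⊨-⋁⁺ (a ∷ l) f (there a∈l) h = inj₂ (⊨-⋁⁺ l f a∈l h)

  ⊨-⋁⁻ : ∀ {m} {A : Set} (l : List A) (f : A → BForm s m) {P : Pointed s m} →
    P ⊨ ⋁ l f → Σ A λ a → P ⊨ f a
  ⊨-⋁⁻ [] f h = ⊥-elim (h refl)
  ⊨-⋁⁻ (a ∷ l) f (inj₁ h) = a , h
  ⊨-⋁⁻ (a ∷ l) f (inj₂ h) = ⊨-⋁⁻ l f h

  literal : ∀ {m} {A : Set} → Dec A → BForm s m → BForm s m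
  literal (yes _) φ = φ
  literal (no _) φ = notB φ

  ⊨-literal : ∀ {m} {P : Pointed s m} φ (P⊨φ? : Dec (P ⊨ φ)) → P ⊨ literal P⊨φ? φ
  ⊨-literal φ (yes h) = h
  ⊨-literal φ (no h) = h

  literal-agrees : ∀ {m} {P Q : Pointed s m} φ (P⊨φ? : Dec (P ⊨ φ)) →
    Q ⊨ literal P⊨φ? φ → P ⊨ φ ⇔ Q ⊨ φ
  literal-agrees φ (yes h) h′ = mk⇔ (λ _ → h′) (λ _ → h)
  literal-agrees φ (no h) h′ = mk⇔ (λ h″ → ⊥-elim (h h″)) (λ h″ → ⊥-elim (h′ h″))

  allVars : ∀ m → List (Var m)
  allVars m = xbar ∷ map var (allFin m)

  ∈-allVars : ∀ {m} (v : Var m) → v ∈ allVars m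
  ∈-allVars xbar = here refl
  ∈-allVars (var i) = there (∈-map⁺ var (∈-allFin i))

  orderLiterals : ∀ {m} → Pointed s m → Var m → Var m → BForm s m
  orderLiterals P v v′ =
    andB (literal (P ⟦ v ⟧ <? P ⟦ v′ ⟧) (ltB v v′)) (literal (P ⟦ v ⟧ ≟ P ⟦ v′ ⟧) (eqB v v′))

  letterAndOrder : ∀ {m} → Pointed s m → Var m → BForm s m
  letterAndOrder {m} P v = andB (letB (lookup (word P) (P ⟦ v ⟧)) v) (⋀ (allVars m) (orderLiterals P v))

  atomicType : ∀ {m} → Pointed s m → BForm s m
  atomicType {m} P = ⋀ (allVars m) (letterAndOrder P)

  qd-atomicType : ∀ {d m} (P : Pointed s m) → qdB (atomicType P) ≤ d
  qd-atomicType {m = m} P = qd-⋀ (allVars m) _ λ v → ⊔-lub z≤n (qd-⋀ (allVars m) _ λ v′ →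
    ⊔-lub (qd-literal (P ⟦ v ⟧ <? P ⟦ v′ ⟧) z≤n) (qd-literal (P ⟦ v ⟧ ≟ P ⟦ v′ ⟧) z≤n))
    where
    qd-literal : ∀ {A : Set} {d φ} (A? : Dec A) → qdB φ ≤ d → qdB (literal A? φ) ≤ d
    qd-literal (yes _) q = q
    qd-literal (no _) q = q

  ⊨-atomicType : ∀ {m} (P : Pointed s m) → P ⊨ atomicType P
  ⊨-atomicType {m} P = ⊨-⋀⁺ (allVars m) (letterAndOrder P) λ {v} _ →
    refl , ⊨-⋀⁺ (allVars m) (orderLiterals P v) λ {v′} _ →
      ⊨-literal (ltB v v′) (P ⟦ v ⟧ <? P ⟦ v′ ⟧) , ⊨-literal (eqB v v′) (P ⟦ v ⟧ ≟ P ⟦ v′ ⟧)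

  atomicType-sound : ∀ {m} {P Q : Pointed s m} → Q ⊨ atomicType P → P ≈[ 0 ] Q
  atomicType-sound {m} {P} {Q} h = ≈-intro prime
    where
    letterAndOrder-at : ∀ v → Q ⊨ letterAndOrder P v
    letterAndOrder-at v = ⊨-⋀⁻ (allVars m) (letterAndOrder P) h (∈-allVars v)
    order : ∀ v v′ → Q ⊨ orderLiterals P v v′
    order v v′ = ⊨-⋀⁻ (allVars m) (orderLiterals P v) (proj₂ (letterAndOrder-at v)) (∈-allVars v′)
    prime : ∀ {φ} → Prime φ → qdB φ ≤ 0 → P ⊨ φ ⇔ Q ⊨ φ
    prime (ltB v v′) _ = literal-agrees (ltB v v′) (P ⟦ v ⟧ <? P ⟦ v′ ⟧) (proj₁ (order v v′))
    prime (eqB v v′) _ = literal-agrees (eqB v v′) (P ⟦ v ⟧ ≟ P ⟦ v′ ⟧) (proj₂ (order v v′))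
    prime (letB a v) _ = mk⇔ (trans letter) (trans (sym letter))
      where
      letter : lookup (word Q) (Q ⟦ v ⟧) ≡ lookup (word P) (P ⟦ v ⟧)
      letter = proj₁ (letterAndOrder-at v)

  below : ∀ {m} (P : Pointed s m) → List (Pos (word P))
  below P = filter (_<? mark P) (allFin _)

  hintikka : ℕ → ∀ {m} → Pointed s m → BForm s m
  hintikka zero P = atomicType P
  hintikka (suc d) P = andB (atomicType P) (andB
    (⋀ (below P) λ p → exB (hintikka d (P ▷ p)))
    (allB (⋁ (allFin _) λ p → hintikka d (P ▷ p))))

  qd-hintikka : ∀ d {m} (P : Pointed s m) → qdB (hintikka d P) ≤ d
  qd-hintikka zero P = qd-atomicType P
  qd-hintikka (suc d) P = ⊔-lub (qd-atomicType P) (⊔-lub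
    (qd-⋀ (below P) _ λ p → s≤s (qd-hintikka d (P ▷ p)))
    (s≤s (qd-⋁ (allFin _) _ λ p → qd-hintikka d (P ▷ p))))

  ⊨-hintikka : ∀ d {m} (P : Pointed s m) → P ⊨ hintikka d P
  ⊨-hintikka zero P = ⊨-atomicType P
  ⊨-hintikka (suc d) P = ⊨-atomicType P ,
    ⊨-⋀⁺ (below P) _ (λ {p} p∈below →
      p , proj₂ (∈-filter⁻ (_<? mark P) {xs = allFin _} p∈below) , ⊨-hintikka d (P ▷ p)) ,
    λ p _ → ⊨-⋁⁺ (allFin _) _ (∈-allFin p) (⊨-hintikka d (P ▷ p))

  hintikka-sound : ∀ d {m} {P Q : Pointed s m} → Q ⊨ hintikka d P → P ≈[ d ] Q
  hintikka-sound zero h = atomicType-sound h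
  hintikka-sound (suc d) {P = P} {Q} (h₀ , h∃ , h∀) = ≈-back-and-forth (atomicType-sound h₀) forth back
    where
    forth : Forth d P Q
    forth p p<b with ⊨-⋀⁻ (below P) _ h∃ (∈-filter⁺ (_<? mark P) (∈-allFin p) p<b)
    ... | r , r<c , h = r , r<c , hintikka-sound d h
    back : Back d P Q
    back r r<c with ⊨-⋁⁻ (allFin _) _ (h∀ r r<c)
    ... | p , h = p , from (e (ltB (var zero) xbar) z≤n) r<c , e  -- the atom var 0 < x̄ transfers r < c
      where
      e : P ▷ p ≈[ d ] Q ▷ r
      e = hintikka-sound d h

  ≈-forth : ∀ {d m} {P Q : Pointed s m} → P ≈[ suc d ] Q → Forth d P Q
  ≈-forth {d} {P = P} e p p<b
    with to (e (exB (hintikka d (P ▷ p))) (s≤s (qd-hintikka d (P ▷ p)))) (p , p<b , ⊨-hintikka d (P ▷ p))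
  ... | r , r<c , h = r , r<c , hintikka-sound d h

  shift : ∀ {n} → Var n → Var (suc n)
  shift xbar = xbar
  shift (var i) = var (suc i)

  lift : ∀ {m n} → (Var m → Var n) → Var (suc m) → Var (suc n)
  lift f xbar = shift (f xbar)
  lift f (var zero) = var zero
  lift f (var (suc i)) = shift (f (var i))

  rename : ∀ {m n} → (Var m → Var n) → BForm s m → BForm s n
  rename f (ltB v v′) = ltB (f v) (f v′)
  rename f (eqB v v′) = eqB (f v) (f v′)
  rename f (letB a v) = letB a (f v)
  rename f (notB φ) = notB (rename f φ)
  rename f (andB φ ψ) = andB (rename f φ) (rename f ψ)
  rename f (orB φ ψ) = orB (rename f φ) (rename f ψ)
  rename f (exB φ) = exB (rename (lift f) φ)
  rename f (allB φ) = allB (rename (lift f) φ)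

  qd-rename : ∀ {m n} (f : Var m → Var n) φ → qdB (rename f φ) ≡ qdB φ
  qd-rename f (ltB v v′) = refl
  qd-rename f (eqB v v′) = refl
  qd-rename f (letB a v) = refl
  qd-rename f (notB φ) = qd-rename f φ
  qd-rename f (andB φ ψ) = cong₂ _⊔_ (qd-rename f φ) (qd-rename f ψ)
  qd-rename f (orB φ ψ) = cong₂ _⊔_ (qd-rename f φ) (qd-rename f ψ)
  qd-rename f (exB φ) = cong suc (qd-rename (lift f) φ)
  qd-rename f (allB φ) = cong suc (qd-rename (lift f) φ)

  ⟦⟧-shift : ∀ {n} (P : Pointed s n) p u → (P ▷ p) ⟦ shift u ⟧ ≡ P ⟦ u ⟧
  ⟦⟧-shift P p xbar = refl
  ⟦⟧-shift P p (var i) = refl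

  ⟦⟧-lift : ∀ {m n} (f : Var m → Var n) {x b} {ρ : Fin m → Pos x} {σ : Fin n → Pos x} →
    (∀ v → ⟨ x , b , σ ⟩ ⟦ f v ⟧ ≡ ⟨ x , b , ρ ⟩ ⟦ v ⟧) →
    ∀ p v → (⟨ x , b , σ ⟩ ▷ p) ⟦ lift f v ⟧ ≡ (⟨ x , b , ρ ⟩ ▷ p) ⟦ v ⟧
  ⟦⟧-lift f h p xbar = trans (⟦⟧-shift _ p (f xbar)) (h xbar)
  ⟦⟧-lift f h p (var zero) = refl
  ⟦⟧-lift f h p (var (suc i)) = trans (⟦⟧-shift _ p (f (var i))) (h (var i))

  ⊨-rename : ∀ {m n} (f : Var m → Var n) φ {x b} {ρ : Fin m → Pos x} {σ : Fin n → Pos x} →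
    (∀ v → ⟨ x , b , σ ⟩ ⟦ f v ⟧ ≡ ⟨ x , b , ρ ⟩ ⟦ v ⟧) →
    ⟨ x , b , σ ⟩ ⊨ rename f φ ⇔ ⟨ x , b , ρ ⟩ ⊨ φ
  ⊨-rename f (ltB v v′) h = ≡⇒ (cong₂ Fin._<_ (h v) (h v′))
  ⊨-rename f (eqB v v′) h = ≡⇒ (cong₂ _≡_ (h v) (h v′))
  ⊨-rename f (letB a v) {x} h = ≡⇒ (cong (λ p → lookup x p ≡ a) (h v))
  ⊨-rename f (notB φ) h = ¬-cong-⇔ (⊨-rename f φ h)
  ⊨-rename f (andB φ ψ) h = ⊨-rename f φ h ×-⇔ ⊨-rename f ψ h
  ⊨-rename f (orB φ ψ) h = ⊨-rename f φ h ⊎-⇔ ⊨-rename f ψ h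
  ⊨-rename f (exB φ) h = mk⇔
    (λ (p , p<b , h′) → p , p<b , to (⊨-rename (lift f) φ (⟦⟧-lift f h p)) h′)
    (λ (p , p<b , h′) → p , p<b , from (⊨-rename (lift f) φ (⟦⟧-lift f h p)) h′)
  ⊨-rename f (allB φ) h = mk⇔
    (λ h′ p p<b → to (⊨-rename (lift f) φ (⟦⟧-lift f h p)) (h′ p p<b))
    (λ h′ p p<b → from (⊨-rename (lift f) φ (⟦⟧-lift f h p)) (h′ p p<b))

  pin : ∀ {m} → Var (suc m) → Var m
  pin xbar = xbar
  pin (var zero) = xbar
  pin (var (suc i)) = var i

  ⟦⟧-pin : ∀ {m} (P : Pointed s m) v → P ⟦ pin v ⟧ ≡ (P ▷ mark P) ⟦ v ⟧
  ⟦⟧-pin P xbar = refl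
  ⟦⟧-pin P (var zero) = refl
  ⟦⟧-pin P (var (suc i)) = refl

  -- Renaming the newest variable to x̄ turns a formula about P ▷ mark P into one about P.
  ≈-pin : ∀ {d m} {P Q : Pointed s m} → P ≈[ d ] Q → P ▷ mark P ≈[ d ] Q ▷ mark Q
  ≈-pin {P = P} {Q} e φ q = ⇔.trans (⇔.sym (⊨-rename pin φ (⟦⟧-pin P)))
    (⇔.trans (e (rename pin φ) (subst (_≤ _) (sym (qd-rename pin φ)) q)) (⊨-rename pin φ (⟦⟧-pin Q)))

  ≈-forth≤ : ∀ {d m} {P Q : Pointed s m} → P ≈[ suc d ] Q → ∀ p → p Fin.≤ mark P →
    Σ (Pos (word Q)) λ r → r Fin.≤ mark Q × P ▷ p ≈[ d ] Q ▷ r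
  ≈-forth≤ e p p≤b with m≤n⇒m<n∨m≡n p≤b
  ... | inj₁ p<b = let (r , r<c , e′) = ≈-forth e p p<b in r , <⇒≤ r<c , e′
  ... | inj₂ p≡b rewrite toℕ-injective p≡b = _ , ≤-refl , ≈-pin (≈-weaken (n≤1+n _) e)

  EnvBelowMark : ∀ {m} → Pointed s m → Set
  EnvBelowMark P = ∀ i → env P i Fin.≤ mark P

  ▷-envBelowMark : ∀ {m} {P : Pointed s m} {p} →
    EnvBelowMark P → p Fin.≤ mark P → EnvBelowMark (P ▷ p)
  ▷-envBelowMark ρ≤b p≤b zero = p≤b
  ▷-envBelowMark ρ≤b p≤b (suc i) = ρ≤b i

module _ {s : ℕ} (x z : Word s) where

  inject++ : Pos x → Pos (x ++ z)
  inject++ i = inject≤ i (length-++-≤ˡ x)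

  toℕ-inject++ : ∀ i → toℕ (inject++ i) ≡ toℕ i
  toℕ-inject++ i = toℕ-inject≤ i (length-++-≤ˡ x)

  inject++-fromℕ< : ∀ (p : Pos (x ++ z)) (p<∣x∣ : toℕ p < length x) → inject++ (fromℕ< p<∣x∣) ≡ p
  inject++-fromℕ< p p<∣x∣ = toℕ-injective (trans (toℕ-inject++ _) (toℕ-fromℕ< p<∣x∣))

lookup-inject++ : ∀ {s} (x z : Word s) i → lookup (x ++ z) (inject++ x z i) ≡ lookup x i
lookup-inject++ (a ∷ x) z zero = refl
lookup-inject++ (a ∷ x) z (suc i) = lookup-inject++ x z i

module _ {s : ℕ} (x z : Word s) where

  -- A bounded formula only sees the positions up to the mark, so it cannot tell x from x ++ z.
  ≈-++ : ∀ d {m} {b : Pos x} {ρ : Fin m → Pos x} {σ : Fin m → Pos (x ++ z)} →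
    (∀ i → σ i ≡ inject++ x z (ρ i)) → ⟨ x , b , ρ ⟩ ≈[ d ] ⟨ x ++ z , inject++ x z b , σ ⟩
  ≈-++ zero {m} {b} {ρ} {σ} σ≡ρ = ≈-intro prime
    where
    P : Pointed s m
    P = ⟨ x , b , ρ ⟩
    Q : Pointed s m
    Q = ⟨ x ++ z , inject++ x z b , σ ⟩
    ⟦⟧-inject : ∀ v → Q ⟦ v ⟧ ≡ inject++ x z (P ⟦ v ⟧)
    ⟦⟧-inject xbar = refl
    ⟦⟧-inject (var i) = σ≡ρ i
    toℕ-⟦⟧ : ∀ v → toℕ (Q ⟦ v ⟧) ≡ toℕ (P ⟦ v ⟧)
    toℕ-⟦⟧ v = trans (cong toℕ (⟦⟧-inject v)) (toℕ-inject++ x z _)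
    prime : ∀ {φ} → Prime φ → qdB φ ≤ 0 → P ⊨ φ ⇔ Q ⊨ φ
    prime (ltB v v′) _ = ≡⇒ (sym (cong₂ _<_ (toℕ-⟦⟧ v) (toℕ-⟦⟧ v′)))
    prime (eqB v v′) _ = mk⇔
      (λ h → toℕ-injective (trans (toℕ-⟦⟧ v) (trans (cong toℕ h) (sym (toℕ-⟦⟧ v′)))))
      (λ h → toℕ-injective (trans (sym (toℕ-⟦⟧ v)) (trans (cong toℕ h) (toℕ-⟦⟧ v′))))
    prime (letB a v) _ =
      ≡⇒ (cong (_≡ a) (sym (trans (cong (lookup (x ++ z)) (⟦⟧-inject v)) (lookup-inject++ x z _))))
  ≈-++ (suc d) {b = b} {ρ} {σ} σ≡ρ = ≈-back-and-forth (≈-++ zero σ≡ρ) forth back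
    where
    extend-inject : ∀ {p r} → r ≡ inject++ x z p →
      ∀ i → extend (x ++ z) r σ i ≡ inject++ x z (extend x p ρ i)
    extend-inject r≡p zero = r≡p
    extend-inject r≡p (suc i) = σ≡ρ i
    forth : Forth d ⟨ x , b , ρ ⟩ ⟨ x ++ z , inject++ x z b , σ ⟩
    forth p p<b = inject++ x z p ,
      subst₂ _<_ (sym (toℕ-inject++ x z p)) (sym (toℕ-inject++ x z b)) p<b ,
      ≈-++ d (extend-inject refl)
    back : Back d ⟨ x , b , ρ ⟩ ⟨ x ++ z , inject++ x z b , σ ⟩
    back r r<b = fromℕ< r<∣x∣ , subst₂ _<_ (sym (toℕ-fromℕ< r<∣x∣)) (toℕ-inject++ x z b) r<b ,
      ≈-++ d (extend-inject (sym (inject++-fromℕ< x z r r<∣x∣)))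
      where
      r<∣x∣ : toℕ r < length x
      r<∣x∣ = <-≤-trans (subst (toℕ r <_) (toℕ-inject++ x z b) r<b) (<⇒≤ (toℕ<n b))

module _ {s m : ℕ} {X Y : Word s} {b b′ : Pos X} {c c′ : Pos Y}
  {ρ : Fin m → Pos X} {σ : Fin m → Pos Y}
  (b⋖b′ : b ⋖ b′) (c⋖c′ : c ⋖ c′) (same : lookup X b′ ≡ lookup Y c′)
  (ρ≤b : EnvBelowMark ⟨ X , b , ρ ⟩) (σ≤c : EnvBelowMark ⟨ Y , c , σ ⟩)
  (e : ⟨ X , b , ρ ⟩ ≈[ 0 ] ⟨ Y , c , σ ⟩) where

  ⊨-advance-atomic : ∀ {α} → Prime α → qdB α ≤ 0 →
    ⟨ X , b′ , ρ ⟩ ⊨ α → ⟨ Y , c′ , σ ⟩ ⊨ α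
  ⊨-advance-atomic (ltB xbar xbar) _ h = ⊥-elim (<-irrefl refl h)
  ⊨-advance-atomic (ltB xbar (var j)) _ h = ⊥-elim (⋖⇒≰ b⋖b′ (≤-trans (<⇒≤ h) (ρ≤b j)))
  ⊨-advance-atomic (ltB (var i) xbar) _ h = ≤-⋖⇒< c⋖c′ (σ≤c i)
  ⊨-advance-atomic (ltB (var i) (var j)) _ h = to (e (ltB (var i) (var j)) z≤n) h
  ⊨-advance-atomic (eqB xbar xbar) _ h = refl
  ⊨-advance-atomic (eqB xbar (var j)) _ h = ⊥-elim (⋖⇒≰ b⋖b′ (subst (Fin._≤ b) (sym h) (ρ≤b j)))
  ⊨-advance-atomic (eqB (var i) xbar) _ h = ⊥-elim (⋖⇒≰ b⋖b′ (subst (Fin._≤ b) h (ρ≤b i)))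
  ⊨-advance-atomic (eqB (var i) (var j)) _ h = to (e (eqB (var i) (var j)) z≤n) h
  ⊨-advance-atomic (letB a xbar) _ h = trans (sym same) h
  ⊨-advance-atomic (letB a (var i)) _ h = to (e (letB a (var i)) z≤n) h

module _ {s : ℕ} {X Y : Word s} {b b′ : Pos X} {c c′ : Pos Y}
  (b⋖b′ : b ⋖ b′) (c⋖c′ : c ⋖ c′) (same : lookup X b′ ≡ lookup Y c′) where

  -- The positions below b′ are those up to b, and ≈-forth≤ matches them with those up to c.
  ≈-advance : ∀ d {m} {ρ : Fin m → Pos X} {σ : Fin m → Pos Y} →
    EnvBelowMark ⟨ X , b , ρ ⟩ → EnvBelowMark ⟨ Y , c , σ ⟩ →
    ⟨ X , b , ρ ⟩ ≈[ d ] ⟨ Y , c , σ ⟩ → ⟨ X , b′ , ρ ⟩ ≈[ d ] ⟨ Y , c′ , σ ⟩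
  ≈-advance zero ρ≤b σ≤c e = ≈-intro λ α q → mk⇔
    (⊨-advance-atomic b⋖b′ c⋖c′ same ρ≤b σ≤c e α q)
    (⊨-advance-atomic c⋖c′ b⋖b′ (sym same) σ≤c ρ≤b (≈-sym e) α q)
  ≈-advance (suc d) {ρ = ρ} {σ} ρ≤b σ≤c e =
    ≈-back-and-forth (≈-advance zero ρ≤b σ≤c (≈-weaken z≤n e)) forth back
    where
    forth : Forth d ⟨ X , b′ , ρ ⟩ ⟨ Y , c′ , σ ⟩
    forth p p<b′ with ≈-forth≤ e p (<-⋖⇒≤ b⋖b′ p<b′)
    ... | r , r≤c , e′ = r , ≤-⋖⇒< c⋖c′ r≤c ,
      ≈-advance d (▷-envBelowMark ρ≤b (<-⋖⇒≤ b⋖b′ p<b′)) (▷-envBelowMark σ≤c r≤c) e′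
    back : Back d ⟨ X , b′ , ρ ⟩ ⟨ Y , c′ , σ ⟩
    back r r<c′ with ≈-forth≤ (≈-sym e) r (<-⋖⇒≤ c⋖c′ r<c′)
    ... | p , p≤b , e′ = p , ≤-⋖⇒< b⋖b′ p≤b ,
      ≈-advance d (▷-envBelowMark ρ≤b p≤b) (▷-envBelowMark σ≤c (<-⋖⇒≤ c⋖c′ r<c′))
        (≈-sym e′)

module _ {s : ℕ} {X Y : Word s} where

  advance-along-suffix : ∀ {b : Pos X} {c : Pos Y} {b″} → b Fin.< b″ →
    drop (suc (toℕ b)) X ≡ drop (suc (toℕ c)) Y →
    Σ (Pos X) λ b′ → Σ (Pos Y) λ c′ →
      b ⋖ b′ × c ⋖ c′ × lookup X b′ ≡ lookup Y c′ ×
      drop (suc (toℕ b′)) X ≡ drop (suc (toℕ c′)) Y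
  advance-along-suffix {b} {c} {b″} b<b″ suffix =
    let (c′ , c⋖c′ , same , rest) = drop-∷⁻ Y (suc (toℕ c)) (trans (sym suffix) dropX)
    in b′ , c′ , b⋖b′ , c⋖c′ , sym same , trans (sym rest) (cong (λ n → drop (suc n) Y) (sym c⋖c′))
    where
    b+1<∣X∣ : suc (toℕ b) < length X
    b+1<∣X∣ = ≤-<-trans b<b″ (toℕ<n b″)
    b′ : Pos X
    b′ = fromℕ< b+1<∣X∣
    b⋖b′ : b ⋖ b′
    b⋖b′ = toℕ-fromℕ< b+1<∣X∣
    dropX : drop (suc (toℕ b)) X ≡ lookup X b′ ∷ drop (suc (toℕ b′)) X
    dropX = subst (λ n → drop n X ≡ lookup X b′ ∷ drop (suc (toℕ b′)) X) b⋖b′ (drop-lookup X b′)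

  ≈-along-common-suffix : ∀ d {b : Pos X} {c : Pos Y} →
    drop (suc (toℕ b)) X ≡ drop (suc (toℕ c)) Y → X at b ≈[ d ] Y at c →
    ∀ b″ → b Fin.≤ b″ → Σ (Pos Y) λ c″ → X at b″ ≈[ d ] Y at c″
  ≈-along-common-suffix d {b} suffix e b″ b≤b″ =
    go (toℕ b″ ∸ toℕ b) suffix e (sym (m∸n+n≡m b≤b″))
    where
    go : ∀ k {b c} → drop (suc (toℕ b)) X ≡ drop (suc (toℕ c)) Y → X at b ≈[ d ] Y at c →
      toℕ b″ ≡ k + toℕ b → Σ (Pos Y) λ c″ → X at b″ ≈[ d ] Y at c″
    go zero suffix e b″≡b = _ , subst (λ p → X at p ≈[ d ] _) (toℕ-injective (sym b″≡b)) e
    go (suc k) {b} suffix e b″≡b+k+1 =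
      let (b′ , c′ , b⋖b′ , c⋖c′ , same , suffix′) = advance-along-suffix b<b″ suffix
      in go k suffix′ (≈-advance b⋖b′ c⋖c′ same d (λ ()) (λ ()) e)
            (trans b″≡b+k+1 (trans (sym (+-suc k (toℕ b))) (cong (k +_) (sym b⋖b′))))
      where
      b<b″ : b Fin.< b″
      b<b″ = ≤-trans (s≤s (m≤n+m (toℕ b) k)) (≤-reflexive (sym b″≡b+k+1))

module _ {s : ℕ} where

  ≈-at-++ : ∀ d (x z : Word s) (b : Pos x) → x at b ≈[ d ] (x ++ z) at inject++ x z b
  ≈-at-++ d x z b = ≈-++ x z d (λ ())

  PositionTypes⊆ : ℕ → Word s → Word s → Set
  PositionTypes⊆ d x y = (b : Pos x) → Σ (Pos y) λ c → x at b ≈[ d ] y at c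

  SameType-sym : ∀ {k} {x y : Word s} → SameType k x y → SameType k y x
  SameType-sym same φ q = ⇔.sym (same φ q)

  SameType⇒PositionTypes⊆ : ∀ {d} {x y : Word s} → SameType (suc d) x y → PositionTypes⊆ d x y
  SameType⇒PositionTypes⊆ {d} {x} same b
    with to (same (exBar (hintikka d (x at b))) (s≤s (qd-hintikka d (x at b)))) (b , ⊨-hintikka d (x at b))
  ... | c , h = c , hintikka-sound d h

  PositionTypes⊆⇒SameType : ∀ {d} {x y : Word s} →
    PositionTypes⊆ d x y → PositionTypes⊆ d y x → SameType (suc d) x y
  PositionTypes⊆⇒SameType xy yx (exBar φ) (s≤s q) = mk⇔
    (λ (b , h) → let (c , e) = xy b in c , to (e φ q) h)
    (λ (c , h) → let (b , e) = yx c in b , to (e φ q) h)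
  PositionTypes⊆⇒SameType xy yx (allBar φ) (s≤s q) = mk⇔
    (λ h c → let (b , e) = yx c in from (e φ q) (h b))
    (λ h b → let (c , e) = xy b in from (e φ q) (h c))
  PositionTypes⊆⇒SameType xy yx (notS φ) q = ¬-cong-⇔ (PositionTypes⊆⇒SameType xy yx φ q)
  PositionTypes⊆⇒SameType xy yx (andS φ ψ) q =
    PositionTypes⊆⇒SameType xy yx φ (m⊔n≤o⇒m≤o (qd φ) _ q) ×-⇔
    PositionTypes⊆⇒SameType xy yx ψ (m⊔n≤o⇒n≤o (qd φ) _ q)
  PositionTypes⊆⇒SameType xy yx (orS φ ψ) q =
    PositionTypes⊆⇒SameType xy yx φ (m⊔n≤o⇒m≤o (qd φ) _ q) ⊎-⇔
    PositionTypes⊆⇒SameType xy yx ψ (m⊔n≤o⇒n≤o (qd φ) _ q)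

  -- Positions up to b are handled inside w and u; beyond b the two words run in lockstep.
  PositionTypes⊆-++ : ∀ d (w z u v : Word s) {b : Pos w} {c : Pos u} →
    PositionTypes⊆ d w u → w at b ≈[ d ] u at c →
    drop (suc (toℕ b)) (w ++ z) ≡ drop (suc (toℕ c)) (u ++ v) →
    PositionTypes⊆ d (w ++ z) (u ++ v)
  PositionTypes⊆-++ d w z u v {b} {c} wu e suffix b′ with ≤-total b′ (inject++ w z b)
  ... | inj₁ b′≤b = inject++ u v (proj₁ (wu i)) ,
    ≈-trans (subst (λ p → (w ++ z) at p ≈[ d ] w at i) (inject++-fromℕ< w z b′ b′<∣w∣)
                   (≈-sym (≈-at-++ d w z i)))
            (≈-trans (proj₂ (wu i)) (≈-at-++ d u v (proj₁ (wu i))))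
    where
    b′<∣w∣ : toℕ b′ < length w
    b′<∣w∣ = ≤-<-trans b′≤b (subst (_< length w) (sym (toℕ-inject++ w z b)) (toℕ<n b))
    i : Pos w
    i = fromℕ< b′<∣w∣
  ... | inj₂ b≤b′ = ≈-along-common-suffix d suffix′ e′ b′ b≤b′
    where
    suffix′ : drop (suc (toℕ (inject++ w z b))) (w ++ z) ≡ drop (suc (toℕ (inject++ u v c))) (u ++ v)
    suffix′ = subst₂ (λ m n → drop (suc m) (w ++ z) ≡ drop (suc n) (u ++ v))
                     (sym (toℕ-inject++ w z b)) (sym (toℕ-inject++ u v c)) suffix
    e′ : (w ++ z) at inject++ w z b ≈[ d ] (u ++ v) at inject++ u v c
    e′ = ≈-trans (≈-sym (≈-at-++ d w z b)) (≈-trans e (≈-at-++ d u v c))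

lemma4 : {s : ℕ} (k : ℕ) → 1 ≤ k → (u v w : Word s) →
    SameType k w u →
    Σ (Word s) (λ w′ → SameType k (w ++ w′) (u ++ v))
lemma4 (suc d) _ [] v [] _ = v , λ _ _ → ⇔.refl
lemma4 (suc d) _ (a ∷ u) v [] same with from (same (exBar ⊤B) (s≤s z≤n)) (zero , refl)
... | () , _
lemma4 {s} (suc d) _ u v w@(a ∷ w₀) same =
  w′ , PositionTypes⊆⇒SameType (PositionTypes⊆-++ d w w′ u v wu e suffix)
                               (PositionTypes⊆-++ d u v w w′ uw (≈-sym e) (sym suffix))
  where
  wu : PositionTypes⊆ d w u
  wu = SameType⇒PositionTypes⊆ same
  uw : PositionTypes⊆ d u w
  uw = SameType⇒PositionTypes⊆ (SameType-sym same)
  last : Pos w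
  last = fromℕ (length w₀)
  c : Pos u
  c = proj₁ (wu last)
  e : w at last ≈[ d ] u at c
  e = proj₂ (wu last)
  w′ : Word s
  w′ = drop (suc (toℕ c)) (u ++ v)
  suffix : drop (suc (toℕ last)) (w ++ w′) ≡ w′
  suffix = trans (cong (λ n → drop (suc n) (w ++ w′)) (toℕ-fromℕ (length w₀))) (drop-length-++ w₀ w′)
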